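{- Let $G$ be a graph. If $G$ contains a simply bad subgraph $J$ such that $G-V(J)$ has a $1$-factor, then $G$ is simply bad.
   Context: Graphs are finite and simple. For a graph $G$ with a $1$-factor $F$: a cycle $C$ is $F$-alternating if $|E(C)|=2|E(F)\cap E(C)|$; in an orientation of $G$ an even cycle $C$ is evenly (resp. oddly) oriented if, for either direction of traversal, the number of edges of $C$ directed along the traversal is even (resp. odd); a zero-sum $F$-set is a finite family $\{C_1,\ldots,C_k\}$ of $F$-alternating cycles such that every edge of $G$ lies in an even number of its members, and it is an odd $F$-set if $k$ is odd. A graph $G$ is simply bad if it has a $1$-factor $F$ such that $G$ has an odd $F$-set $\mathcal{A}$ and an orientation in which every member of $\mathcal{A}$ is evenly oriented. -}

module Defs where

open import Data.Nat using (ℕ; zero; suc; _≤_)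
open import Data.Nat.DivMod using (_mod_)
open import Data.Nat.Divisibility using (_∣_)
open import Data.Fin using (Fin; toℕ)
open import Data.Fin.Properties using () renaming (_≟_ to _≟ᶠ_)
open import Data.Bool using (Bool; true; false; _∧_; _∨_; not; if_then_else_)
open import Data.List using (List; map; allFin; length; filter)
open import Data.Nat.ListAction using (sum)
open import Data.Bool.ListAction using (any)
open import Data.List.Relation.Unary.All using (All)
open import Data.Product using (Σ; _×_; _,_)
open import Relation.Nullary using (¬_)
open import Relation.Nullary.Decidable using (⌊_⌋)
open import Relation.Binary.PropositionalEquality using (_≡_; refl)

-- A finite simple graph whose vertex set is a subset of Fin n.
-- V v = true  iff v is a vertex; Adj u v = true iff uv is an edge.
record Graph (n : ℕ) : Set where
  field
    V      : Fin n → Bool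
    Adj    : Fin n → Fin n → Bool
    sym    : ∀ u v → Adj u v ≡ Adj v u
    irrefl : ∀ v → Adj v v ≡ false
    closed : ∀ u v → Adj u v ≡ true → V u ≡ true
open Graph public

_⊑_ : ∀ {n} → Graph n → Graph n → Set
J ⊑ G = (∀ v → V J v ≡ true → V G v ≡ true)
      × (∀ u v → Adj J u v ≡ true → Adj G u v ≡ true)

private
  ∧-false : ∀ b → b ∧ false ≡ false
  ∧-false true = refl
  ∧-false false = refl

  ∧-true₁ : ∀ a b → a ∧ b ≡ true → a ≡ true
  ∧-true₁ true b _ = refl

  ∧-true₂ : ∀ a b → a ∧ b ≡ true → b ≡ true
  ∧-true₂ true true _ = refl

  ∧-intro : ∀ a b → a ≡ true → b ≡ true → a ∧ b ≡ true
  ∧-intro true true _ _ = refl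

  ∧-comm : ∀ a b → a ∧ b ≡ b ∧ a
  ∧-comm true true = refl
  ∧-comm true false = refl
  ∧-comm false true = refl
  ∧-comm false false = refl

_─V_ : ∀ {n} → Graph n → Graph n → Graph n
G ─V J = record
  { V      = λ v → V G v ∧ not (V J v)
  ; Adj    = λ u v → Adj G u v ∧ (not (V J u) ∧ not (V J v))
  ; sym    = symP
  ; irrefl = irr
  ; closed = cl
  }
  where
  symP : ∀ u v → Adj G u v ∧ (not (V J u) ∧ not (V J v)) ≡ Adj G v u ∧ (not (V J v) ∧ not (V J u))
  symP u v rewrite sym G u v | ∧-comm (not (V J u)) (not (V J v)) = refl
  irr : ∀ v → Adj G v v ∧ (not (V J v) ∧ not (V J v)) ≡ false
  irr v rewrite irrefl G v = refl
  cl : ∀ u v → Adj G u v ∧ (not (V J u) ∧ not (V J v)) ≡ true → V G u ∧ not (V J u) ≡ true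
  cl u v e = ∧-intro (V G u) (not (V J u))
               (closed G u v (∧-true₁ _ _ e))
               (∧-true₁ _ _ (∧-true₂ (Adj G u v) _ e))

record OneFactor {n} (G : Graph n) : Set where
  field
    M       : Fin n → Fin n → Bool
    M-sym   : ∀ u v → M u v ≡ M v u
    M-sub   : ∀ u v → M u v ≡ true → Adj G u v ≡ true
    perfect : ∀ v → V G v ≡ true →
              Σ (Fin n) λ u → (M v u ≡ true) × (∀ w → M v w ≡ true → w ≡ u)
open OneFactor public

HasOneFactor : ∀ {n} → Graph n → Set
HasOneFactor G = OneFactor G

next : ∀ {k} → Fin k → Fin k
next {suc k} i = suc (toℕ i) mod suc k

count : (k : ℕ) → (Fin k → Bool) → ℕ
count k p = sum (map (λ i → if p i then 1 else 0) (allFin k))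

record Cycle {n} (G : Graph n) : Set where
  field
    len   : ℕ
    len≥3 : 3 ≤ len
    vert  : Fin len → Fin n
    inj   : ∀ i j → vert i ≡ vert j → i ≡ j
    adj   : ∀ i → Adj G (vert i) (vert (next i)) ≡ true
open Cycle public

|F∩C| : ∀ {n} {G : Graph n} → OneFactor G → Cycle G → ℕ
|F∩C| F C = count (len C) (λ i → M F (vert C i) (vert C (next i)))

Alternating : ∀ {n} {G : Graph n} → OneFactor G → Cycle G → Set
Alternating F C = len C ≡ 2 Data.Nat.* |F∩C| F C

record Orientation {n} (G : Graph n) : Set where
  field
    arc    : Fin n → Fin n → Bool
    orient : ∀ u v → Adj G u v ≡ true → arc v u ≡ not (arc u v)
open Orientation public

Even : ℕ → Set
Even m = 2 ∣ m

Odd : ℕ → Set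
Odd m = ¬ (2 ∣ m)

EvenlyOriented : ∀ {n} {G : Graph n} → Orientation G → Cycle G → Set
EvenlyOriented D C =
    Even (count (len C) (λ i → arc D (vert C i) (vert C (next i))))
  × Even (count (len C) (λ i → arc D (vert C (next i)) (vert C i)))

edgeIn : ∀ {n} {G : Graph n} → Cycle G → Fin n → Fin n → Bool
edgeIn C u v = any (λ i → (⌊ vert C i ≟ᶠ u ⌋ ∧ ⌊ vert C (next i) ≟ᶠ v ⌋)
                        ∨ (⌊ vert C i ≟ᶠ v ⌋ ∧ ⌊ vert C (next i) ≟ᶠ u ⌋))
                   (allFin (len C))

ZeroSum : ∀ {n} {G : Graph n} → List (Cycle G) → Set
ZeroSum {G = G} 𝒜 = ∀ u v → Adj G u v ≡ true →
  Even (length (filter (λ C → edgeIn C u v Data.Bool.≟ true) 𝒜))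

OddFSet : ∀ {n} {G : Graph n} → OneFactor G → List (Cycle G) → Set
OddFSet F 𝒜 = All (Alternating F) 𝒜 × ZeroSum 𝒜 × Odd (length 𝒜)

SimplyBad : ∀ {n} → Graph n → Set
SimplyBad G = Σ (OneFactor G) λ F → Σ (List (Cycle G)) λ 𝒜 →
  OddFSet F 𝒜 × Σ (Orientation G) λ D → All (EvenlyOriented D) 𝒜

module Submission where

-- A 1-factor of G is the union of a 1-factor F of J and one of G − V(J), and any orientation
-- of J extends to one of G (orienting the remaining edges by vertex index). Every quantity in
-- the definition of "simply bad" for a family of cycles of J (alternation, orientation parities,
-- edge multiplicities) only involves edges of J, on which the new 1-factor and orientation agree
-- with F and the old orientation; an edge of G outside J lies on no member at all.

open import Defs
open import Data.Nat using (ℕ; zero; suc; _*_; _<ᵇ_)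
open import Data.Nat.Divisibility using (_∣0)
open import Data.Nat.ListAction using (sum)
open import Data.Fin using (Fin; toℕ)
open import Data.Fin.Properties using (toℕ-injective) renaming (_≟_ to _≟ᶠ_)
open import Data.Bool using (Bool; true; false; T; _∧_; not; if_then_else_)
open import Data.Bool.Properties using (T-≡; T-∧; T-∨; ∧-conicalˡ; ∧-conicalʳ) renaming (_≟_ to _≟ᵇ_)
open import Data.List using (List; []; _∷_; map; allFin; length; filter)
open import Data.List.Properties using (length-map; map-cong; filter-none)
open import Data.List.Relation.Unary.All as All using (All)
open import Data.List.Relation.Unary.All.Properties using (gmap⁺)
open import Data.List.Relation.Unary.Any using (satisfied)
open import Data.List.Relation.Unary.Any.Properties using (any⁻)
open import Data.Empty using (⊥-elim)
open import Data.Product using (Σ; _×_; _,_; proj₂)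
open import Data.Sum using ([_,_])
open import Function using (_∘_; Equivalence)
open import Relation.Nullary using (does)
open import Relation.Nullary.Decidable using (⌊_⌋; toWitness)
open import Relation.Unary using (Pred; Decidable)
open import Relation.Binary.PropositionalEquality as ≡ using (_≡_; _≢_; refl; trans; cong; cong₂; subst; subst₂)

<ᵇ-flip : ∀ m n → m ≢ n → (n <ᵇ m) ≡ not (m <ᵇ n)
<ᵇ-flip zero    zero    m≢n = ⊥-elim (m≢n refl)
<ᵇ-flip zero    (suc n) _   = refl
<ᵇ-flip (suc m) zero    _   = refl
<ᵇ-flip (suc m) (suc n) m≢n = <ᵇ-flip m n (m≢n ∘ cong suc)

length-filter-map : ∀ {A B : Set} {ℓ} {P : Pred B ℓ} (P? : Decidable P) (f : A → B) xs →
  length (filter P? (map f xs)) ≡ length (filter (P? ∘ f) xs)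
length-filter-map P? f []       = refl
length-filter-map P? f (x ∷ xs) with does (P? (f x))
... | true  = cong suc (length-filter-map P? f xs)
... | false = length-filter-map P? f xs

count-cong : ∀ k {p q : Fin k → Bool} → (∀ i → p i ≡ q i) → count k p ≡ count k q
count-cong k p≡q = cong sum (map-cong (λ i → cong (λ b → if b then 1 else 0) (p≡q i)) (allFin k))

edgeIn⇒Adj : ∀ {n} {G : Graph n} (C : Cycle G) u v → edgeIn C u v ≡ true → Adj G u v ≡ true
edgeIn⇒Adj {n} {G} C u v e =
  let i , hit = satisfied (any⁻ _ (allFin (len C)) (Equivalence.from T-≡ e)) in
  [ traversed i , (λ t → trans (Graph.sym G u v) (traversed i t)) ]
    (Equivalence.to (T-∨ {traverses i u v} {traverses i v u}) hit)
  where
  traverses : Fin (len C) → Fin n → Fin n → Bool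
  traverses i a b = ⌊ vert C i ≟ᶠ a ⌋ ∧ ⌊ vert C (next i) ≟ᶠ b ⌋

  traversed : ∀ i {a b} → T (traverses i a b) → Adj G a b ≡ true
  traversed i {a} {b} t =
    let p , q = Equivalence.to (T-∧ {⌊ vert C i ≟ᶠ a ⌋} {⌊ vert C (next i) ≟ᶠ b ⌋}) t in
    subst₂ (λ a b → Adj G a b ≡ true) (toWitness p) (toWitness q) (adj C i)

edgeIn-nonEdge : ∀ {n} {G : Graph n} u v → Adj G u v ≡ false →
                 (C : Cycle G) → edgeIn C u v ≢ true
edgeIn-nonEdge u v uv∉G C uv∈C with () ← trans (≡.sym (edgeIn⇒Adj C u v uv∈C)) uv∉G

module Lift {n} {J G : Graph n} (sub : J ⊑ G) where

  liftCycle : Cycle J → Cycle G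
  liftCycle C = record
    { len = len C ; len≥3 = len≥3 C ; vert = vert C ; inj = inj C
    ; adj = λ i → proj₂ sub _ _ (adj C i) }

  alternating-lift : {FJ : OneFactor J} {FG : OneFactor G} →
    (∀ u v → Adj J u v ≡ true → M FG u v ≡ M FJ u v) →
    ∀ {𝒜} → All (Alternating FJ) 𝒜 → All (Alternating FG) (map liftCycle 𝒜)
  alternating-lift agree = gmap⁺ λ {C} alt →
    trans alt (cong (2 *_) (count-cong (len C) λ i →
      ≡.sym (agree (vert C i) (vert C (next i)) (adj C i))))

  evenlyOriented-lift : {DJ : Orientation J} {DG : Orientation G} →
    (∀ u v → Adj J u v ≡ true → arc DG u v ≡ arc DJ u v) →
    ∀ {𝒜} → All (EvenlyOriented DJ) 𝒜 → All (EvenlyOriented DG) (map liftCycle 𝒜)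
  evenlyOriented-lift agree = gmap⁺ λ {C} (along , against) →
    subst Even (count-cong (len C) λ i →
      ≡.sym (agree (vert C i) (vert C (next i)) (adj C i))) along ,
    subst Even (count-cong (len C) λ i →
      ≡.sym (agree (vert C (next i)) (vert C i) (trans (Graph.sym J _ _) (adj C i)))) against

  zeroSum-lift : (𝒜 : List (Cycle J)) → ZeroSum 𝒜 → ZeroSum (map liftCycle 𝒜)
  zeroSum-lift 𝒜 zs u v _ rewrite length-filter-map (λ C → edgeIn C u v ≟ᵇ true) liftCycle 𝒜
    with Adj J u v in uv∈J
  ... | true  = zs u v uv∈J
  ... | false
    rewrite filter-none (λ C → edgeIn C u v ≟ᵇ true) (All.universal (edgeIn-nonEdge u v uv∈J) 𝒜)
    = 2 ∣0

module OneFactorUnion {n} {J G : Graph n} (sub : J ⊑ G)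
                      (FJ : OneFactor J) (FH : OneFactor (G ─V J)) where

  private
    M∪ : Fin n → Fin n → Bool
    M∪ u v = if V J u then M FJ u v else M FH u v

    MJ-outside : ∀ u v → V J v ≡ false → M FJ u v ≡ false
    MJ-outside u v v∉J with M FJ u v in uv∈F
    ... | false = refl
    ... | true with () ← trans (≡.sym (closed J v u (trans (Graph.sym J v u) (M-sub FJ u v uv∈F))))
                                v∉J

    MH-inside : ∀ u v → V J v ≡ true → M FH u v ≡ false
    MH-inside u v v∈J with M FH u v in uv∈F
    ... | false = refl
    ... | true with () ← subst (λ b → not b ≡ true) v∈J
                            (∧-conicalʳ (not (V J u)) _ (∧-conicalʳ (Adj G u v) _ (M-sub FH u v uv∈F)))

    M∪-sym : ∀ u v → M∪ u v ≡ M∪ v u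
    M∪-sym u v with V J u in u∈J | V J v in v∈J
    ... | true  | true  = M-sym FJ u v
    ... | true  | false = trans (MJ-outside u v v∈J) (≡.sym (MH-inside v u u∈J))
    ... | false | true  = trans (MH-inside u v v∈J) (≡.sym (MJ-outside v u u∈J))
    ... | false | false = M-sym FH u v

    M∪-sub : ∀ u v → M∪ u v ≡ true → Adj G u v ≡ true
    M∪-sub u v uv∈F with V J u
    ... | true  = proj₂ sub u v (M-sub FJ u v uv∈F)
    ... | false = ∧-conicalˡ _ _ (M-sub FH u v uv∈F)

    M∪-perfect : ∀ v → V G v ≡ true →
                 Σ (Fin n) λ u → (M∪ v u ≡ true) × (∀ w → M∪ v w ≡ true → w ≡ u)
    M∪-perfect v v∈G with V J v in v∈J
    ... | true  = perfect FJ v v∈J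
    ... | false = perfect FH v (cong₂ (λ a b → a ∧ not b) v∈G v∈J)

  oneFactor-∪ : OneFactor G
  oneFactor-∪ = record { M = M∪ ; M-sym = M∪-sym ; M-sub = M∪-sub ; perfect = M∪-perfect }

  oneFactor-∪-agrees : ∀ u v → Adj J u v ≡ true → M oneFactor-∪ u v ≡ M FJ u v
  oneFactor-∪-agrees u v uv∈J rewrite closed J u v uv∈J = refl

module ExtendOrientation {n} {J : Graph n} (G : Graph n) (DJ : Orientation J) where

  private
    arc⁺ : Fin n → Fin n → Bool
    arc⁺ u v = if Adj J u v then arc DJ u v else (toℕ u <ᵇ toℕ v)

    arc⁺-orient : ∀ u v → Adj G u v ≡ true → arc⁺ v u ≡ not (arc⁺ u v)
    arc⁺-orient u v uv∈G rewrite Graph.sym J v u with Adj J u v in uv∈J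
    ... | true  = orient DJ u v uv∈J
    ... | false = <ᵇ-flip (toℕ u) (toℕ v) λ u≡v → loop (toℕ-injective u≡v)
      where
      loop : u ≢ v
      loop refl with () ← trans (≡.sym uv∈G) (irrefl G u)

  extendOrientation : Orientation G
  extendOrientation = record { arc = arc⁺ ; orient = arc⁺-orient }

  extendOrientation-agrees : ∀ u v → Adj J u v ≡ true → arc extendOrientation u v ≡ arc DJ u v
  extendOrientation-agrees u v uv∈J rewrite uv∈J = refl

lemma3p8 : ∀ {n : ℕ} (G J : Graph n) → J ⊑ G → SimplyBad J → HasOneFactor (G ─V J) → SimplyBad G
lemma3p8 G J sub (FJ , 𝒜 , (alternating , zeroSum , odd) , DJ , evenlyOriented) FH =
  oneFactor-∪ , map liftCycle 𝒜 ,
  ( alternating-lift {FJ} {oneFactor-∪} oneFactor-∪-agrees alternating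
  , zeroSum-lift 𝒜 zeroSum
  , subst Odd (≡.sym (length-map liftCycle 𝒜)) odd ) ,
  extendOrientation ,
  evenlyOriented-lift {DJ} {extendOrientation} extendOrientation-agrees evenlyOriented
  where
  open Lift {J = J} {G = G} sub
  open OneFactorUnion {J = J} {G = G} sub FJ FH
  open ExtendOrientation G DJ
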